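{- Let $\pi$ be a permutation of $[n]$, $\bm{x}$ an optimal displacement vector of $\pi$, and $L,L'\in\mathcal{L}^{\mathrm{opt}}(\pi,\bm{x})$. Then there exists a reconfiguration sequence under braid relations between $L$ and $L'$, and one can construct such a sequence.
   Context: Let $[n]=\{1,\dots,n\}$ and $\pi$ a permutation of $[n]$. A cyclic ladder lottery of $\pi$ consists of $n$ vertical lines $1,\dots,n$ and finitely many horizontal bars at distinct heights. Each bar connects lines $k,k+1$ ($1\le k\le n-1$) or lines $n,1$. Start with element $i$ on top of line $i$ and sweep downward; each bar swaps the two elements on its lines. At the bottom, line $j$ must carry $\pi_j$. It is optimal if it has the minimum number of bars. Routes of elements form $n$ $y$-monotone pseudolines on a cylinder whose intersections are the bars; lotteries are identified as pseudoline arrangements. $\mathit{DV}(L)=(x_1,\dots,x_n)$, where $x_i$ is the number of bars at which element $i$ moves one line right (line $k\to k+1$ or $n\to1$) minus the number at which it moves left. An optimal displacement vector is $\mathit{DV}(L)$ for some optimal $L$. $\mathcal{L}^{\mathrm{opt}}(\pi,\bm{x})$ is the set of optimal cyclic ladder lotteries $L$ of $\pi$ with $\mathit{DV}(L)=\bm{x}$. A triple of elements is tangled if its three pseudolines pairwise cross. It is minimal if the region they enclose contains no part of another pseudoline. A braid relation applied to a minimal tangled triple passes one of its pseudolines across the intersection of the other two. In terms of bars, it replaces consecutive bars on lines $(k,k+1),(k+1,k+2),(k,k+1)$ by $(k+1,k+2),(k,k+1),(k+1,k+2)$, indices mod $n$, or the reverse. A reconfiguration sequence under braid relations is a sequence of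 lotteries in which each is obtained from the previous one by one braid relation. -}

module Defs where

open import Data.Nat as ℕ using (ℕ; zero; suc; _≤_)
open import Data.Fin as Fin using (Fin; zero; suc; toℕ; fromℕ<)
open import Data.Integer as ℤ using (ℤ; 0ℤ; 1ℤ; -1ℤ)
open import Data.List using (List; []; _∷_; _++_; length)
open import Data.Product using (_×_; _,_; ∃; ∃-syntax; proj₁; proj₂)
open import Data.Sum using (_⊎_)
open import Data.Fin.Permutation using (Permutation′; _⟨$⟩ʳ_)
open import Relation.Binary.PropositionalEquality using (_≡_; _≢_)
open import Relation.Nullary using (yes; no)
open import Relation.Binary.Construct.Closure.ReflexiveTransitive using (Star)

-- Lines and elements are 0-indexed: Fin n stands for [n] (line/element i+1).

next : ∀ {n} → Fin n → Fin n
next {suc m} i with suc (toℕ i) ℕ.<? suc m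
... | yes p = fromℕ< p
... | no _  = zero

-- A bar is identified by k : Fin n; it connects lines k and next k.
-- A lottery is the list of its bars, from top to bottom.
Bar : ℕ → Set
Bar n = Fin n

Lottery : ℕ → Set
Lottery n = List (Bar n)

-- State: line j carries element (σ j).
State : ℕ → Set
State n = Fin n → Fin n

applyBar : ∀ {n} → Bar n → State n → State n
applyBar k σ j with j Fin.≟ k | j Fin.≟ next k
... | yes _ | _     = σ (next k)
... | no _  | yes _ = σ k
... | no _  | no _  = σ j

updDV : ∀ {n} → Bar n → State n → (Fin n → ℤ) → (Fin n → ℤ)
updDV k σ d e with e Fin.≟ σ k | e Fin.≟ σ (next k)
... | yes _ | yes _ = d e
... | yes _ | no _  = d e ℤ.+ 1ℤ
... | no _  | yes _ = d e ℤ.+ -1ℤ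
... | no _  | no _  = d e

run : ∀ {n} → State n → (Fin n → ℤ) → Lottery n → State n × (Fin n → ℤ)
run σ d []      = σ , d
run σ d (k ∷ L) = run (applyBar k σ) (updDV k σ d) L

initState : ∀ {n} → State n
initState j = j

final : ∀ {n} → Lottery n → State n
final L = proj₁ (run initState (λ _ → 0ℤ) L)

DV : ∀ {n} → Lottery n → Fin n → ℤ
DV L = proj₂ (run initState (λ _ → 0ℤ) L)

IsLotteryOf : ∀ {n} → Permutation′ n → Lottery n → Set
IsLotteryOf π L = ∀ j → final L j ≡ π ⟨$⟩ʳ j

IsOptimal : ∀ {n} → Permutation′ n → Lottery n → Set
IsOptimal {n} π L = IsLotteryOf π L × (∀ (L′ : Lottery n) → IsLotteryOf π L′ → length L ≤ length L′)

IsOptimalDV : ∀ {n} → Permutation′ n → (Fin n → ℤ) → Set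
IsOptimalDV {n} π x = ∃[ L ] (IsOptimal π L × (∀ i → DV L i ≡ x i))

InLopt : ∀ {n} → Permutation′ n → (Fin n → ℤ) → Lottery n → Set
InLopt π x L = IsOptimal π L × (∀ i → DV L i ≡ x i)

Disjoint : ∀ {n} → Bar n → Bar n → Set
Disjoint k k′ = k ≢ k′ × k ≢ next k′ × next k ≢ k′ × next k ≢ next k′

-- Exchanging the heights of two consecutive bars on disjoint lines does not
-- change the pseudoline arrangement (same lottery).
data CommStep {n} : Lottery n → Lottery n → Set where
  comm : ∀ (A B : Lottery n) (k k′ : Bar n) → Disjoint k k′ →
         CommStep (A ++ k ∷ k′ ∷ B) (A ++ k′ ∷ k ∷ B)

data BraidStep {n} : Lottery n → Lottery n → Set where
  braid  : ∀ (A B : Lottery n) (k : Bar n) →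
           BraidStep (A ++ k ∷ next k ∷ k ∷ B) (A ++ next k ∷ k ∷ next k ∷ B)
  braid⁻ : ∀ (A B : Lottery n) (k : Bar n) →
           BraidStep (A ++ next k ∷ k ∷ next k ∷ B) (A ++ k ∷ next k ∷ k ∷ B)

Move : ∀ {n} → Lottery n → Lottery n → Set
Move L L′ = CommStep L L′ ⊎ BraidStep L L′

Reconf : ∀ {n} → Lottery n → Lottery n → Set
Reconf = Star Move

-- Lift the cylinder to its universal cover and identify the cover with ℤ (line j of sheet w
-- becomes j + n w). Bar k then acts on ℤ by exchanging i and i + 1 whenever i ≡ k (mod n), so a
-- lottery acts as a periodic permutation of ℤ, i.e. an element of the affine symmetric group;
-- element e ends at e + DV e, so this action is determined by the displacement vector, and an
-- optimal lottery with displacement vector x is a reduced word for the resulting affine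
-- permutation. The claim is thus Matsumoto's theorem for the affine symmetric group, proved by
-- induction on the length through the exchange property: strands that never cross keep their
-- order, so a word equal to a reduced word s ∷ A must cross the two strands exchanged by s, and
-- deleting that crossing rewrites the word as s ∷ W′. Two different first letters s, t are then
-- reconciled by a commutation or a braid move. With two lines there are no braid moves, but
-- reduced words alternate, which forces equal first letters.
module Submission where

open import Defs
open import Function using (id; _∘_)
open import Data.Nat as ℕ using (ℕ; zero; suc; _≤_; _<_)
import Data.Nat.Properties as ℕₚ
open import Data.Fin as Fin using (Fin; toℕ)
import Data.Fin.Properties as Finₚ
open import Data.Integer using (ℤ; +_; -[1+_]; 0ℤ; 1ℤ; -1ℤ; _+_; _-_; _*_; -_)
import Data.Integer.Properties as ℤₚ
open import Algebra.Properties.AbelianGroup ℤₚ.+-0-abelianGroup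
  using () renaming (∙-cancelˡ to +-cancelˡ; ∙-cancelʳ to +-cancelʳ)
open import Algebra.Properties.CommutativeSemigroup ℤₚ.+-commutativeSemigroup
  using () renaming (xy∙z≈xz∙y to +-swapʳ)
open import Data.Integer.Tactic.RingSolver using (solve-∀)
open import Data.Fin.Permutation using (Permutation′; _⟨$⟩ʳ_)
open import Data.List using ([]; _∷_; length)
open import Data.Product using (_×_; _,_; proj₁; proj₂; ∃)
open import Data.Product.Properties using (≡-dec)
open import Data.Sum using (_⊎_; inj₁; inj₂)
open import Data.Empty using (⊥-elim)
open import Relation.Nullary using (¬_; Dec; yes; no)
open import Relation.Nullary.Decidable using (_⊎-dec_; _×-dec_)
open import Relation.Binary.PropositionalEquality
open import Relation.Binary.Construct.Closure.ReflexiveTransitive using (ε; _◅_; _◅◅_; gmap)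

infix 4 _≺_
record _≺_ (x y : ℤ) : Set where
  constructor gap
  field
    size     : ℕ
    equality : y ≡ x + + suc size

open _≺_ using (size)

≺-irrefl : ∀ {x} → ¬ x ≺ x
≺-irrefl {x} (gap k x≡x+k+1) with +-cancelˡ x (+ suc k) 0ℤ (trans (sym x≡x+k+1) (sym (ℤₚ.+-identityʳ x)))
... | ()

≺-trans : ∀ {x y z} → x ≺ y → y ≺ z → x ≺ z
≺-trans {x} (gap k refl) (gap l refl) =
  gap (k ℕ.+ suc l) (trans (ℤₚ.+-assoc x (+ suc k) (+ suc l)) (cong (_+_ x) (sym (ℤₚ.pos-+ (suc k) (suc l)))))

≺-asym : ∀ {x y} → x ≺ y → ¬ y ≺ x
≺-asym x≺y y≺x = ≺-irrefl (≺-trans x≺y y≺x)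

y≡x+[y-x] : ∀ x y → y ≡ x + (y - x)
y≡x+[y-x] = solve-∀

x≡y-[y-x] : ∀ x y → x ≡ y - (y - x)
x≡y-[y-x] = solve-∀

≺-trichotomy : ∀ x y → x ≡ y ⊎ x ≺ y ⊎ y ≺ x
≺-trichotomy x y with y - x in y-x≡
... | + zero   = inj₁ (sym (trans (y≡x+[y-x] x y) (trans (cong (_+_ x) y-x≡) (ℤₚ.+-identityʳ x))))
... | + suc k  = inj₂ (inj₁ (gap k (trans (y≡x+[y-x] x y) (cong (_+_ x) y-x≡))))
... | -[1+ k ] = inj₂ (inj₂ (gap k (trans (x≡y-[y-x] x y) (cong (_-_ y) y-x≡))))

-- The displacements enter as dy + (- dx + gap) so that, for the literals 0ℤ, 1ℤ and -1ℤ,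
-- the new gap reduces to a numeral and the side condition is proved by refl.
≺-shift : ∀ {x y x′ y′ k′} dx dy → x′ ≡ x + dx → y′ ≡ y + dy → (x≺y : x ≺ y) →
          dy + (- dx + + suc (size x≺y)) ≡ + suc k′ → x′ ≺ y′
≺-shift {x} {k′ = k′} dx dy refl refl (gap k refl) new-gap = gap k′ (begin
  x + + suc k + dy                  ≡⟨ regroup x dx dy (+ suc k) ⟩
  x + dx + (dy + (- dx + + suc k))  ≡⟨ cong (_+_ (x + dx)) new-gap ⟩
  x + dx + + suc k′                 ∎)
  where
    open ≡-Reasoning
    regroup : ∀ x dx dy g → x + g + dy ≡ x + dx + (dy + (- dx + g))
    regroup = solve-∀

module Cover (m : ℕ) where

  n : ℕ
  n = suc (suc m)

  wrap : Fin n → ℤ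
  wrap j with suc (toℕ j) ℕ.<? n
  ... | yes _ = 0ℤ
  ... | no _  = 1ℤ

  toℕ-next : ∀ (j : Fin n) → toℕ (next j) ≡ suc (toℕ j) ⊎ (toℕ (next j) ≡ 0 × suc (toℕ j) ≡ n)
  toℕ-next j with suc (toℕ j) ℕ.<? n
  ... | yes j+1<n = inj₁ (Finₚ.toℕ-fromℕ< j+1<n)
  ... | no  j+1≮n = inj₂ (refl , ℕₚ.≤-antisym (Finₚ.toℕ<n j) (ℕₚ.≮⇒≥ j+1≮n))

  toℕ-next+wrap : ∀ (j : Fin n) → + toℕ (next j) + + n * wrap j ≡ + toℕ j + 1ℤ
  toℕ-next+wrap j with suc (toℕ j) ℕ.<? n
  ... | yes j+1<n rewrite Finₚ.toℕ-fromℕ< j+1<n = shuffle (+ toℕ j) (+ n)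
    where shuffle : ∀ t b → (1ℤ + t) + b * 0ℤ ≡ t + 1ℤ
          shuffle = solve-∀
  ... | no  j+1≮n = begin
    0ℤ + + n * 1ℤ    ≡⟨ ℤₚ.*-identityʳ (+ n) ⟩
    + n              ≡⟨ cong +_ (ℕₚ.≤-antisym (ℕₚ.≮⇒≥ j+1≮n) (Finₚ.toℕ<n j)) ⟩
    1ℤ + + toℕ j     ≡⟨ ℤₚ.+-comm 1ℤ (+ toℕ j) ⟩
    + toℕ j + 1ℤ     ∎
    where open ≡-Reasoning

  next≢id : ∀ (a : Fin n) → next a ≢ a
  next≢id a next≡a with toℕ-next a
  ... | inj₁ toℕ-next≡ = ℕₚ.1+n≢n (trans (sym toℕ-next≡) (cong toℕ next≡a))
  ... | inj₂ (toℕ-next≡0 , a+1≡n) with () ← trans (sym a+1≡n) (cong suc (trans (sym (cong toℕ next≡a)) toℕ-next≡0))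

  next-injective : ∀ {a b : Fin n} → next a ≡ next b → a ≡ b
  next-injective {a} {b} eq with toℕ-next a | toℕ-next b
  ... | inj₁ p       | inj₁ q       = Finₚ.toℕ-injective (ℕₚ.suc-injective (trans (sym p) (trans (cong toℕ eq) q)))
  ... | inj₁ p       | inj₂ (q , _) with () ← trans (sym p) (trans (cong toℕ eq) q)
  ... | inj₂ (p , _) | inj₁ q       with () ← trans (sym q) (trans (cong toℕ (sym eq)) p)
  ... | inj₂ (_ , p) | inj₂ (_ , q) = Finₚ.toℕ-injective (ℕₚ.suc-injective (trans p (sym q)))

  n≢2 : 0 < m → n ≢ 2
  n≢2 0<m n≡2 = ℕₚ.<⇒≢ 0<m (sym (ℕₚ.suc-injective (ℕₚ.suc-injective n≡2)))

  next²≢id : 0 < m → ∀ (a : Fin n) → next (next a) ≢ a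
  next²≢id 0<m a next²a≡a with toℕ-next a | toℕ-next (next a) | cong toℕ next²a≡a
  ... | inj₁ p       | inj₁ q       | r = ℕₚ.m≢1+n+m (toℕ a) (trans (sym r) (trans q (cong suc p)))
  ... | inj₁ p       | inj₂ (q , s) | r = n≢2 0<m (trans (sym s) (cong suc (trans p (cong suc (trans (sym r) q)))))
  ... | inj₂ (p , s) | inj₁ q       | r = n≢2 0<m (trans (sym s) (cong suc (trans (sym r) (trans q (cong suc p)))))
  ... | inj₂ (p , _) | inj₂ (_ , s) | _ with () ← trans (sym s) (cong suc p)

  -- (j , w) is the point over line j on sheet w of the universal cover of the cylinder.
  Pos : Set
  Pos = Fin n × ℤ

  line : Pos → Fin n
  line = proj₁

  base : Fin n → Pos
  base j = j , 0ℤ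

  right : Pos → Pos
  right (j , w) = next j , w + wrap j

  leftOf : Fin n → Pos → Pos
  leftOf a (_ , w) = a , w - wrap a

  shift : ℤ → Pos → Pos
  shift k (j , w) = j , w + k

  toℤ : Pos → ℤ
  toℤ (j , w) = + toℕ j + + n * w

  toℤ-raise : ∀ j w c → toℤ (j , w + c) ≡ + toℕ j + + n * c + + n * w
  toℤ-raise j w c = distrib (+ toℕ j) (+ n) w c
    where distrib : ∀ t b w c → t + b * (w + c) ≡ t + b * c + b * w
          distrib = solve-∀

  right∘leftOf : ∀ a p → line p ≡ next a → right (leftOf a p) ≡ p
  right∘leftOf a (_ , w) refl = cong (next a ,_) (cancel w (wrap a))
    where cancel : ∀ w c → w - c + c ≡ w
          cancel = solve-∀

  leftOf∘right : ∀ a p → line p ≡ a → leftOf a (right p) ≡ p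
  leftOf∘right a (_ , w) refl = cong (a ,_) (cancel w (wrap a))
    where cancel : ∀ w c → w + c - c ≡ w
          cancel = solve-∀

  same-line⇒shift : ∀ p q → line p ≡ line q → p ≡ shift (proj₂ p - proj₂ q) q
  same-line⇒shift (j , w) (_ , w′) refl = cong (j ,_) (split w w′)
    where split : ∀ w w′ → w ≡ w′ + (w - w′)
          split = solve-∀

  toℤ-right : ∀ p → toℤ (right p) ≡ toℤ p + 1ℤ
  toℤ-right (j , w) = begin
    toℤ (next j , w + wrap j)               ≡⟨ toℤ-raise (next j) w (wrap j) ⟩
    + toℕ (next j) + + n * wrap j + + n * w ≡⟨ cong (_+ + n * w) (toℕ-next+wrap j) ⟩
    + toℕ j + 1ℤ + + n * w                  ≡⟨ +-swapʳ (+ toℕ j) 1ℤ (+ n * w) ⟩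
    + toℕ j + + n * w + 1ℤ                  ∎
    where open ≡-Reasoning

  toℤ-right² : ∀ p → toℤ (right (right p)) ≡ toℤ p + + 2
  toℤ-right² p = begin
    toℤ (right (right p)) ≡⟨ toℤ-right (right p) ⟩
    toℤ (right p) + 1ℤ    ≡⟨ cong (_+ 1ℤ) (toℤ-right p) ⟩
    toℤ p + 1ℤ + 1ℤ       ≡⟨ ℤₚ.+-assoc (toℤ p) 1ℤ 1ℤ ⟩
    toℤ p + + 2           ∎
    where open ≡-Reasoning

  toℤ-leftOf : ∀ a p → line p ≡ next a → toℤ (leftOf a p) ≡ toℤ p + -1ℤ
  toℤ-leftOf a p p∈next = begin
    toℤ (leftOf a p)              ≡⟨ split (toℤ (leftOf a p)) ⟩
    toℤ (leftOf a p) + 1ℤ + -1ℤ   ≡⟨ cong (_+ -1ℤ) (sym (toℤ-right (leftOf a p))) ⟩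
    toℤ (right (leftOf a p)) + -1ℤ ≡⟨ cong (λ q → toℤ q + -1ℤ) (right∘leftOf a p p∈next) ⟩
    toℤ p + -1ℤ                   ∎
    where
      open ≡-Reasoning
      split : ∀ x → x ≡ x + 1ℤ + -1ℤ
      split = solve-∀

  toℤ-sheet≺ : ∀ j j′ {w w′} → w ≺ w′ → toℤ (j , w) ≢ toℤ (j′ , w′)
  toℤ-sheet≺ j j′ {w} (gap k refl) eq = ℕₚ.<-irrefl refl (begin-strict
    toℕ j                        <⟨ Finₚ.toℕ<n j ⟩
    n                            ≤⟨ ℕₚ.m≤m*n n (suc k) ⟩
    n ℕ.* suc k                  ≤⟨ ℕₚ.m≤n+m (n ℕ.* suc k) (toℕ j′) ⟩
    toℕ j′ ℕ.+ n ℕ.* suc k       ≡⟨ ℤₚ.+-injective j≡ ⟨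
    toℕ j                        ∎)
    where
      open ℕₚ.≤-Reasoning
      j≡ : + toℕ j ≡ + (toℕ j′ ℕ.+ n ℕ.* suc k)
      j≡ = +-cancelʳ (+ n * w) (+ toℕ j) _
             (trans eq (trans (toℤ-raise j′ w (+ suc k))
                              (cong (λ c → + toℕ j′ + c + + n * w) (sym (ℤₚ.pos-* n (suc k))))))

  toℤ-injective : ∀ {p q} → toℤ p ≡ toℤ q → p ≡ q
  toℤ-injective {j , w} {j′ , w′} eq with ≺-trichotomy w w′
  ... | inj₁ refl        = cong (_, w) (Finₚ.toℕ-injective (ℤₚ.+-injective (+-cancelʳ (+ n * w) _ _ eq)))
  ... | inj₂ (inj₁ w≺w′) = ⊥-elim (toℤ-sheet≺ j j′ w≺w′ eq)
  ... | inj₂ (inj₂ w′≺w) = ⊥-elim (toℤ-sheet≺ j′ j w′≺w (sym eq))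

  right²≢id : ∀ p → right (right p) ≢ p
  right²≢id p eq = ≺-irrefl (gap 1 (trans (cong toℤ (sym eq)) (toℤ-right² p)))

  bar : Fin n → Pos → Pos
  bar a p with line p Fin.≟ a | line p Fin.≟ next a
  ... | yes _ | _     = right p
  ... | no _  | yes _ = leftOf a p
  ... | no _  | no _  = p

  data Side (a j : Fin n) : Set where
    source : j ≡ a → Side a j
    target : j ≡ next a → Side a j
    off    : j ≢ a → j ≢ next a → Side a j

  side : ∀ a j → Side a j
  side a j with j Fin.≟ a | j Fin.≟ next a
  ... | yes j≡a | _         = source j≡a
  ... | no _    | yes j≡a′  = target j≡a′
  ... | no j≢a  | no j≢a′   = off j≢a j≢a′

  bar-source : ∀ a p → line p ≡ a → bar a p ≡ right p
  bar-source a p p∈a with line p Fin.≟ a | line p Fin.≟ next a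
  ... | yes _   | _ = refl
  ... | no p∉a  | _ = ⊥-elim (p∉a p∈a)

  bar-target : ∀ a p → line p ≡ next a → bar a p ≡ leftOf a p
  bar-target a p p∈a′ with line p Fin.≟ a | line p Fin.≟ next a
  ... | yes p∈a | _        = ⊥-elim (next≢id a (trans (sym p∈a′) p∈a))
  ... | no _    | yes _    = refl
  ... | no _    | no p∉a′  = ⊥-elim (p∉a′ p∈a′)

  bar-off : ∀ a p → line p ≢ a → line p ≢ next a → bar a p ≡ p
  bar-off a p p∉a p∉a′ with line p Fin.≟ a | line p Fin.≟ next a
  ... | yes p∈a | _        = ⊥-elim (p∉a p∈a)
  ... | no _    | yes p∈a′ = ⊥-elim (p∉a′ p∈a′)
  ... | no _    | no _     = refl

  bar-involutive : ∀ a p → bar a (bar a p) ≡ p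
  bar-involutive a p with side a (line p)
  ... | source p∈a = begin
    bar a (bar a p)   ≡⟨ cong (bar a) (bar-source a p p∈a) ⟩
    bar a (right p)   ≡⟨ bar-target a (right p) (cong next p∈a) ⟩
    leftOf a (right p) ≡⟨ leftOf∘right a p p∈a ⟩
    p                 ∎
    where open ≡-Reasoning
  ... | target p∈a′ = begin
    bar a (bar a p)      ≡⟨ cong (bar a) (bar-target a p p∈a′) ⟩
    bar a (leftOf a p)   ≡⟨ bar-source a (leftOf a p) refl ⟩
    right (leftOf a p)   ≡⟨ right∘leftOf a p p∈a′ ⟩
    p                    ∎
    where open ≡-Reasoning
  ... | off p∉a p∉a′ = trans (cong (bar a) (bar-off a p p∉a p∉a′)) (bar-off a p p∉a p∉a′)

  bar-shift : ∀ a k p → bar a (shift k p) ≡ shift k (bar a p)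
  bar-shift a k p@(j , w) with side a (line p)
  ... | source p∈a = trans (bar-source a (shift k p) p∈a)
                       (trans (cong (next j ,_) (+-swapʳ w k (wrap j))) (cong (shift k) (sym (bar-source a p p∈a))))
  ... | target p∈a′ = trans (bar-target a (shift k p) p∈a′)
                       (trans (cong (a ,_) (+-swapʳ w k (- wrap a))) (cong (shift k) (sym (bar-target a p p∈a′))))
  ... | off p∉a p∉a′ = trans (bar-off a (shift k p) p∉a p∉a′) (cong (shift k) (sym (bar-off a p p∉a p∉a′)))

  toℤ-bar-source : ∀ a p → line p ≡ a → toℤ (bar a p) ≡ toℤ p + 1ℤ
  toℤ-bar-source a p p∈a = trans (cong toℤ (bar-source a p p∈a)) (toℤ-right p)

  toℤ-bar-target : ∀ a p → line p ≡ next a → toℤ (bar a p) ≡ toℤ p + -1ℤ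
  toℤ-bar-target a p p∈a′ = trans (cong toℤ (bar-target a p p∈a′)) (toℤ-leftOf a p p∈a′)

  toℤ-bar-off : ∀ a p → line p ≢ a → line p ≢ next a → toℤ (bar a p) ≡ toℤ p + 0ℤ
  toℤ-bar-off a p p∉a p∉a′ = trans (cong toℤ (bar-off a p p∉a p∉a′)) (sym (ℤₚ.+-identityʳ (toℤ p)))

  ShiftEquivariant : (Pos → Pos) → Set
  ShiftEquivariant g = ∀ k p → g (shift k p) ≡ shift k (g p)

  shiftEquivariant⇒line-cong : ∀ {g} → ShiftEquivariant g → ∀ p q → line p ≡ line q → line (g p) ≡ line (g q)
  shiftEquivariant⇒line-cong {g} g-equiv p q p∥q = cong line (trans (cong g (same-line⇒shift p q p∥q)) (g-equiv _ q))

  record IsCoverMap (g : Pos → Pos) : Set where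
    field
      shift-comm     : ShiftEquivariant g
      line-injective : ∀ p q → line (g p) ≡ line (g q) → line p ≡ line q

  open IsCoverMap

  id-isCoverMap : IsCoverMap id
  id-isCoverMap = record { shift-comm = λ _ _ → refl ; line-injective = λ _ _ p∥q → p∥q }

  ∘-isCoverMap : ∀ {f g} → IsCoverMap f → IsCoverMap g → IsCoverMap (f ∘ g)
  ∘-isCoverMap {f} {g} F G = record
    { shift-comm     = λ k p → trans (cong f (shift-comm G k p)) (shift-comm F k (g p))
    ; line-injective = λ p q → line-injective G p q ∘ line-injective F (g p) (g q)
    }

  bar-isCoverMap : ∀ a → IsCoverMap (bar a)
  bar-isCoverMap a = record { shift-comm = bar-shift a ; line-injective = line-injective′ }
    where
      line-injective′ : ∀ p q → line (bar a p) ≡ line (bar a q) → line p ≡ line q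
      line-injective′ p q eq = subst₂ (λ p′ q′ → line p′ ≡ line q′) (bar-involutive a p) (bar-involutive a q)
                                 (shiftEquivariant⇒line-cong {bar a} (bar-shift a) _ _ eq)

  act : Lottery n → Pos → Pos
  act []      = id
  act (a ∷ W) = act W ∘ bar a

  act-isCoverMap : ∀ W → IsCoverMap (act W)
  act-isCoverMap []      = id-isCoverMap
  act-isCoverMap (a ∷ W) = ∘-isCoverMap (act-isCoverMap W) (bar-isCoverMap a)

  -- Crossings of strands

  Swaps : Fin n → Pos → Pos → Set
  Swaps a u v = (line u ≡ a × v ≡ right u) ⊎ (line v ≡ a × u ≡ right v)

  swaps-sym : ∀ {a u v} → Swaps a u v → Swaps a v u
  swaps-sym (inj₁ s) = inj₂ s
  swaps-sym (inj₂ s) = inj₁ s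

  swaps? : ∀ a u v → Dec (Swaps a u v)
  swaps? a u v = ((line u Fin.≟ a) ×-dec (v ≟ₚ right u)) ⊎-dec ((line v Fin.≟ a) ×-dec (u ≟ₚ right v))
    where _≟ₚ_ = ≡-dec Fin._≟_ ℤₚ._≟_

  data Crossing : Pos → Pos → Lottery n → Set where
    here  : ∀ {a u v W} → Swaps a u v → Crossing u v (a ∷ W)
    there : ∀ {a u v W} → Crossing (bar a u) (bar a v) W → Crossing u v (a ∷ W)

  crossing-sym : ∀ {u v W} → Crossing u v W → Crossing v u W
  crossing-sym (here s)  = here (swaps-sym s)
  crossing-sym (there c) = there (crossing-sym c)

  crossing? : ∀ u v W → Dec (Crossing u v W)
  crossing? u v []      = no λ ()
  crossing? u v (a ∷ W) with swaps? a u v | crossing? (bar a u) (bar a v) W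
  ... | yes s | _     = yes (here s)
  ... | no _  | yes c = yes (there c)
  ... | no ¬s | no ¬c = no λ { (here s) → ¬s s ; (there c) → ¬c c }

  bar-monotone : ∀ a u v → ¬ Swaps a u v → toℤ u ≺ toℤ v → toℤ (bar a u) ≺ toℤ (bar a v)
  bar-monotone a u v ¬s = by-cases (side a (line u)) (side a (line v))
    where
      v≡right-u : toℤ v ≡ toℤ u + 1ℤ → v ≡ right u
      v≡right-u v≡ = toℤ-injective (trans v≡ (sym (toℤ-right u)))

      by-cases : Side a (line u) → Side a (line v) → toℤ u ≺ toℤ v → toℤ (bar a u) ≺ toℤ (bar a v)
      by-cases (source u∈a) (source v∈a) u≺v =
        ≺-shift 1ℤ 1ℤ (toℤ-bar-source a u u∈a) (toℤ-bar-source a v v∈a) u≺v refl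
      by-cases (source u∈a) (target v∈a′) (gap zero v≡) = ⊥-elim (¬s (inj₁ (u∈a , v≡right-u v≡)))
      by-cases (source u∈a) (target v∈a′) (gap 1 v≡) =
        ⊥-elim (next≢id a (next-injective (begin
          next (next a)            ≡⟨ cong (next ∘ next) u∈a ⟨
          line (right (right u))   ≡⟨ cong line (toℤ-injective {right (right u)} {v} (trans (toℤ-right² u) (sym v≡))) ⟩
          line v                   ≡⟨ v∈a′ ⟩
          next a                   ∎)))
        where open ≡-Reasoning
      by-cases (source u∈a) (target v∈a′) u≺v@(gap (suc (suc _)) _) =
        ≺-shift 1ℤ -1ℤ (toℤ-bar-source a u u∈a) (toℤ-bar-target a v v∈a′) u≺v refl
      by-cases (source u∈a) (off v∉a v∉a′) (gap zero v≡) =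
        ⊥-elim (v∉a′ (trans (cong line (v≡right-u v≡)) (cong next u∈a)))
      by-cases (source u∈a) (off v∉a v∉a′) u≺v@(gap (suc _) _) =
        ≺-shift 1ℤ 0ℤ (toℤ-bar-source a u u∈a) (toℤ-bar-off a v v∉a v∉a′) u≺v refl
      by-cases (target u∈a′) (source v∈a) u≺v =
        ≺-shift -1ℤ 1ℤ (toℤ-bar-target a u u∈a′) (toℤ-bar-source a v v∈a) u≺v refl
      by-cases (target u∈a′) (target v∈a′) u≺v =
        ≺-shift -1ℤ -1ℤ (toℤ-bar-target a u u∈a′) (toℤ-bar-target a v v∈a′) u≺v refl
      by-cases (target u∈a′) (off v∉a v∉a′) u≺v =
        ≺-shift -1ℤ 0ℤ (toℤ-bar-target a u u∈a′) (toℤ-bar-off a v v∉a v∉a′) u≺v refl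
      by-cases (off u∉a u∉a′) (source v∈a) u≺v =
        ≺-shift 0ℤ 1ℤ (toℤ-bar-off a u u∉a u∉a′) (toℤ-bar-source a v v∈a) u≺v refl
      by-cases (off u∉a u∉a′) (target v∈a′) (gap zero v≡) =
        ⊥-elim (u∉a (next-injective (trans (cong line (sym (v≡right-u v≡))) v∈a′)))
      by-cases (off u∉a u∉a′) (target v∈a′) u≺v@(gap (suc _) _) =
        ≺-shift 0ℤ -1ℤ (toℤ-bar-off a u u∉a u∉a′) (toℤ-bar-target a v v∈a′) u≺v refl
      by-cases (off u∉a u∉a′) (off v∉a v∉a′) u≺v =
        ≺-shift 0ℤ 0ℤ (toℤ-bar-off a u u∉a u∉a′) (toℤ-bar-off a v v∉a v∉a′) u≺v refl

  act-monotone : ∀ W u v → ¬ Crossing u v W → toℤ u ≺ toℤ v → toℤ (act W u) ≺ toℤ (act W v)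
  act-monotone []      u v _  u≺v = u≺v
  act-monotone (a ∷ W) u v ¬c u≺v =
    act-monotone W (bar a u) (bar a v) (¬c ∘ there) (bar-monotone a u v (¬c ∘ here) u≺v)

  data Ascending : Fin n → Lottery n → Set where
    []   : ∀ {a} → Ascending a []
    step : ∀ {a W} → Ascending (next a) W → Ascending a (a ∷ W)

  data Descending : Fin n → Lottery n → Set where
    []   : ∀ {a} → Descending a []
    step : ∀ {a b W} → next b ≡ a → Descending b W → Descending a (a ∷ W)

  toℤ-act-ascending : ∀ {a W} p → Ascending a W → line p ≡ a → toℤ (act W p) ≡ toℤ p + + length W
  toℤ-act-ascending p [] _ = sym (ℤₚ.+-identityʳ (toℤ p))
  toℤ-act-ascending {a} {a ∷ W} p (step asc) p∈a = begin
    toℤ (act W (bar a p))      ≡⟨ toℤ-act-ascending (bar a p) asc (trans (cong line (bar-source a p p∈a)) (cong next p∈a)) ⟩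
    toℤ (bar a p) + + length W ≡⟨ cong (_+ + length W) (toℤ-bar-source a p p∈a) ⟩
    toℤ p + 1ℤ + + length W    ≡⟨ ℤₚ.+-assoc (toℤ p) 1ℤ (+ length W) ⟩
    toℤ p + + suc (length W)   ∎
    where open ≡-Reasoning

  toℤ-act-descending : ∀ {a W} p → Descending a W → line p ≡ next a → toℤ (act W p) + + length W ≡ toℤ p
  toℤ-act-descending p [] _ = ℤₚ.+-identityʳ (toℤ p)
  toℤ-act-descending {a} {a ∷ W} p (step b′≡a desc) p∈a′ = begin
    toℤ (act W (bar a p)) + + suc (length W) ≡⟨ regroup (toℤ (act W (bar a p))) (+ length W) ⟩
    toℤ (act W (bar a p)) + + length W + 1ℤ  ≡⟨ cong (_+ 1ℤ) (toℤ-act-descending (bar a p) desc bar-a-p∈b′) ⟩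
    toℤ (bar a p) + 1ℤ                       ≡⟨ cong (_+ 1ℤ) (toℤ-bar-target a p p∈a′) ⟩
    toℤ p + -1ℤ + 1ℤ                         ≡⟨ cancel (toℤ p) ⟩
    toℤ p                                    ∎
    where
      open ≡-Reasoning
      bar-a-p∈b′ = trans (cong line (bar-target a p p∈a′)) (sym b′≡a)
      regroup : ∀ x w → x + (1ℤ + w) ≡ x + w + 1ℤ
      regroup = solve-∀
      cancel : ∀ x → x + -1ℤ + 1ℤ ≡ x
      cancel = solve-∀

  bar-swaps : ∀ {a u v} → Swaps a u v → bar a u ≡ v
  bar-swaps {a} {u}     (inj₁ (u∈a , refl)) = bar-source a u u∈a
  bar-swaps {a} {_} {v} (inj₂ (v∈a , refl)) = trans (bar-target a (right v) (cong next v∈a)) (leftOf∘right a v v∈a)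

  swaps-lines : ∀ {a u v} → Swaps a u v → (line u ≡ a ⊎ line v ≡ a) × (line u ≡ next a ⊎ line v ≡ next a)
  swaps-lines (inj₁ (u∈a , refl)) = inj₁ u∈a , inj₂ (cong next u∈a)
  swaps-lines (inj₂ (v∈a , refl)) = inj₂ v∈a , inj₁ (cong next v∈a)

  swaps-base : ∀ s → Swaps s (base s) (right (base s))
  swaps-base s = inj₁ (refl , refl)

  conjugate-along-line : ∀ {g} → IsCoverMap g → ∀ s a z p → line p ≡ line z →
                         bar a (g z) ≡ g (bar s z) → bar a (g p) ≡ g (bar s p)
  conjugate-along-line {g} G s a z p p∥z e = subst (λ q → bar a (g q) ≡ g (bar s q)) (sym (same-line⇒shift p z p∥z)) (begin
    bar a (g (shift k z))   ≡⟨ cong (bar a) (shift-comm G k z) ⟩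
    bar a (shift k (g z))   ≡⟨ bar-shift a k (g z) ⟩
    shift k (bar a (g z))   ≡⟨ cong (shift k) e ⟩
    shift k (g (bar s z))   ≡⟨ shift-comm G k (bar s z) ⟨
    g (shift k (bar s z))   ≡⟨ cong g (bar-shift s k z) ⟨
    g (bar s (shift k z))   ∎)
    where
      open ≡-Reasoning
      k = proj₂ p - proj₂ z

  bar-conjugate : ∀ {g} → IsCoverMap g → ∀ s a → Swaps a (g (base s)) (g (right (base s))) →
                  ∀ p → bar a (g p) ≡ g (bar s p)
  bar-conjugate {g} G s a sw p with side s (line p)
  ... | source p∈s  = conjugate-along-line G s a (base s) p p∈s
                        (trans (bar-swaps sw) (cong g (sym (bar-swaps (swaps-base s)))))
  ... | target p∈s′ = conjugate-along-line G s a (right (base s)) p p∈s′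
                        (trans (bar-swaps (swaps-sym sw)) (cong g (sym (bar-swaps (swaps-sym (swaps-base s))))))
  ... | off p∉s p∉s′ = trans (bar-off a (g p) (avoid (proj₁ (swaps-lines sw))) (avoid (proj₂ (swaps-lines sw))))
                             (cong g (sym (bar-off s p p∉s p∉s′)))
    where
      avoid : ∀ {b} → line (g (base s)) ≡ b ⊎ line (g (right (base s))) ≡ b → line (g p) ≢ b
      avoid (inj₁ u∈b) gp∈b = p∉s  (line-injective G p _ (trans gp∈b (sym u∈b)))
      avoid (inj₂ v∈b) gp∈b = p∉s′ (line-injective G p _ (trans gp∈b (sym v∈b)))

  delete-crossing : ∀ {g} → IsCoverMap g → ∀ s W → Crossing (g (base s)) (g (right (base s))) W →
                    ∃ λ W′ → suc (length W′) ≡ length W × (∀ p → act W (g p) ≡ act W′ (g (bar s p)))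
  delete-crossing G s (a ∷ W) (here sw) = W , refl , λ p → cong (act W) (bar-conjugate G s a sw p)
  delete-crossing G s (a ∷ W) (there c) with delete-crossing (∘-isCoverMap (bar-isCoverMap a) G) s W c
  ... | W′ , len , eq = a ∷ W′ , cong suc len , eq

  Reduced : Lottery n → Set
  Reduced W = ∀ M → act M ≗ act W → length W ≤ length M

  act-cancelˡ : ∀ s X Y → act (s ∷ X) ≗ act (s ∷ Y) → act X ≗ act Y
  act-cancelˡ s X Y eq p = begin
    act X p                 ≡⟨ cong (act X) (bar-involutive s p) ⟨
    act X (bar s (bar s p)) ≡⟨ eq (bar s p) ⟩
    act Y (bar s (bar s p)) ≡⟨ cong (act Y) (bar-involutive s p) ⟩
    act Y p                 ∎
    where open ≡-Reasoning

  reduced-tail : ∀ a W → Reduced (a ∷ W) → Reduced W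
  reduced-tail a W red M eq = ℕₚ.≤-pred (red (a ∷ M) (eq ∘ bar a))

  reduced-resp : ∀ X Y → Reduced X → act Y ≗ act X → length Y ≡ length X → Reduced Y
  reduced-resp X Y red eq len M eq′ = subst (_≤ length M) (sym len) (red M (λ p → trans (eq′ p) (eq p)))

  reduced-no-repeat : ∀ a W → ¬ Reduced (a ∷ a ∷ W)
  reduced-no-repeat a W red =
    ℕₚ.<-irrefl refl (ℕₚ.≤-trans (ℕₚ.n≤1+n _) (red W λ p → cong (act W) (sym (bar-involutive a p))))

  reduced-length : ∀ A B → Reduced A → Reduced B → act A ≗ act B → length A ≡ length B
  reduced-length A B redA redB eq = ℕₚ.≤-antisym (redA B (sym ∘ eq)) (redB A eq)

  -- In the reduced word s ∷ A the strands of base s and right (base s) cross at the head and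
  -- never again (else deleting the second crossing would shorten the word), so they end in
  -- reversed order; a word W that never crossed them would keep them in order.
  reduced⇒crossing : ∀ s A W → Reduced (s ∷ A) → act W ≗ act (s ∷ A) → Crossing (base s) (right (base s)) W
  reduced⇒crossing s A W red eq with crossing? (base s) (right (base s)) W
  ... | yes c = c
  ... | no ¬c with crossing? (bar s (base s)) (bar s (right (base s))) A
  ...   | yes c with delete-crossing (bar-isCoverMap s) s A c
  ...     | A′ , len , eq′ = ⊥-elim (ℕₚ.<-irrefl refl (ℕₚ.≤-trans shortest (ℕₚ.≤-trans (ℕₚ.n≤1+n _) (ℕₚ.≤-reflexive len))))
    where
      shortest : length (s ∷ A) ≤ length A′
      shortest = red A′ λ p → sym (trans (eq′ p) (cong (act A′) (bar-involutive s p)))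
  reduced⇒crossing s A W red eq | no ¬c | no ¬c′ = ⊥-elim (≺-asym in-order reversed)
    where
      u = base s
      v = right u
      in-order : toℤ (act W u) ≺ toℤ (act W v)
      in-order = act-monotone W u v ¬c (gap 0 (toℤ-right u))
      reversed : toℤ (act W v) ≺ toℤ (act W u)
      reversed = subst₂ _≺_ (cong toℤ (sym (eq v))) (cong toℤ (sym (eq u)))
        (act-monotone A (bar s v) (bar s u) (¬c′ ∘ crossing-sym)
          (subst₂ (λ x y → toℤ x ≺ toℤ y) (sym (bar-swaps (swaps-sym (swaps-base s)))) (sym (bar-swaps (swaps-base s)))
            (gap 0 (toℤ-right u))))

  -- Matsumoto's theorem

  Adjacent : Fin n → Fin n → Set
  Adjacent s t = t ≡ next s ⊎ s ≡ next t

  adjacent-or-disjoint : ∀ s t → s ≢ t → Adjacent s t ⊎ Disjoint s t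
  adjacent-or-disjoint s t s≢t with t Fin.≟ next s | s Fin.≟ next t
  ... | yes t≡s′ | _        = inj₁ (inj₁ t≡s′)
  ... | no _     | yes s≡t′ = inj₁ (inj₂ s≡t′)
  ... | no t≢s′  | no s≢t′  = inj₂ (s≢t , s≢t′ , t≢s′ ∘ sym , s≢t ∘ next-injective)

  bar-fixes : ∀ a p {j} → line p ≡ j → a ≢ j → next a ≢ j → bar a p ≡ p
  bar-fixes a p refl a≢ a′≢ = bar-off a p (a≢ ∘ sym) (a′≢ ∘ sym)

  bar-comm : ∀ s t → Disjoint s t → ∀ p → bar s (bar t p) ≡ bar t (bar s p)
  bar-comm s t (s≢t , s≢t′ , s′≢t , s′≢t′) p with side t (line p)
  ... | source p∈t rewrite bar-source t p p∈t
                         | bar-fixes s (right p) (cong next p∈t) s≢t′ s′≢t′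
                         | bar-fixes s p p∈t s≢t s′≢t
                         | bar-source t p p∈t = refl
  ... | target p∈t′ rewrite bar-target t p p∈t′
                          | bar-fixes s (leftOf t p) refl s≢t s′≢t
                          | bar-fixes s p p∈t′ s≢t′ s′≢t′
                          | bar-target t p p∈t′ = refl
  ... | off p∉t p∉t′ rewrite bar-off t p p∉t p∉t′ with side s (line p)
  ...   | source p∈s rewrite bar-source s p p∈s =
    sym (bar-fixes t (right p) (cong next p∈s) (s′≢t ∘ sym) (s′≢t′ ∘ sym))
  ...   | target p∈s′ rewrite bar-target s p p∈s′ = sym (bar-fixes t (leftOf s p) refl (s≢t ∘ sym) (s≢t′ ∘ sym))
  ...   | off p∉s p∉s′ rewrite bar-off s p p∉s p∉s′ = sym (bar-off t p p∉t p∉t′)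

  bar-braid : 0 < m → ∀ a p → bar a (bar (next a) (bar a p)) ≡ bar (next a) (bar a (bar (next a) p))
  bar-braid 0<m a p = by-side (side a (line p))
    where
      a′≢a : next a ≢ a
      a′≢a = next≢id a
      a″≢a : next (next a) ≢ a
      a″≢a = next²≢id 0<m a
      a″≢a′ : next (next a) ≢ next a
      a″≢a′ = a′≢a ∘ next-injective

      by-side : Side a (line p) → bar a (bar (next a) (bar a p)) ≡ bar (next a) (bar a (bar (next a) p))
      by-side (source p∈a) rewrite bar-source a p p∈a
                                 | bar-source (next a) (right p) (cong next p∈a)
                                 | bar-fixes a (right (right p)) (cong (next ∘ next) p∈a) (a″≢a ∘ sym) (a″≢a′ ∘ sym)
                                 | bar-fixes (next a) p p∈a a′≢a a″≢a
                                 | bar-source a p p∈a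
                                 | bar-source (next a) (right p) (cong next p∈a) = refl
      by-side (target p∈a′) rewrite bar-target a p p∈a′
                                  | bar-fixes (next a) (leftOf a p) refl a′≢a a″≢a
                                  | bar-source a (leftOf a p) refl
                                  | right∘leftOf a p p∈a′
                                  | bar-source (next a) p p∈a′
                                  | bar-fixes a (right p) (cong next p∈a′) (a″≢a ∘ sym) (a″≢a′ ∘ sym)
                                  | bar-target (next a) (right p) (cong next p∈a′)
                                  | leftOf∘right (next a) p p∈a′ = refl
      by-side (off p∉a p∉a′) with side (next a) (line p)
      ... | source p∈a′ = ⊥-elim (p∉a′ p∈a′)
      ... | target p∈a″ rewrite bar-off a p p∉a p∉a′
                              | bar-target (next a) p p∈a″
                              | bar-target a (leftOf (next a) p) refl =
        sym (bar-fixes (next a) (leftOf a (leftOf (next a) p)) refl a′≢a a″≢a)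
      ... | off _ p∉a″ rewrite bar-off a p p∉a p∉a′ | bar-off (next a) p p∉a′ p∉a″
                             | bar-off a p p∉a p∉a′ | bar-off (next a) p p∉a′ p∉a″ = refl

  braid-move : 0 < m → ∀ s t D → Adjacent s t →
               act (s ∷ t ∷ s ∷ D) ≗ act (t ∷ s ∷ t ∷ D) × Move (s ∷ t ∷ s ∷ D) (t ∷ s ∷ t ∷ D)
  braid-move 0<m s ._ D (inj₁ refl) = cong (act D) ∘ bar-braid 0<m s , inj₂ (braid [] D s)
  braid-move 0<m ._ t D (inj₂ refl) = cong (act D) ∘ sym ∘ bar-braid 0<m t , inj₂ (braid⁻ [] D t)

  prepend : ∀ (s : Fin n) {X Y} → Reconf X Y → Reconf (s ∷ X) (s ∷ Y)
  prepend s = gmap (s ∷_) cons-move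
    where
      cons-move : ∀ {X Y} → Move X Y → Move (s ∷ X) (s ∷ Y)
      cons-move (inj₁ (comm A B k k′ d)) = inj₁ (comm (s ∷ A) B k k′ d)
      cons-move (inj₂ (braid A B k))     = inj₂ (braid (s ∷ A) B k)
      cons-move (inj₂ (braid⁻ A B k))    = inj₂ (braid⁻ (s ∷ A) B k)

  swaps-base⇒≡ : ∀ {s t} → Swaps t (base s) (right (base s)) → t ≡ s
  swaps-base⇒≡ (inj₁ (s≡t , _))  = sym s≡t
  swaps-base⇒≡ (inj₂ (_ , eq))   = ⊥-elim (right²≢id _ (sym eq))

  -- After bar s the two strands lie over s and next (next s) (if t = next s), or over t and
  -- next (next t) (if s = next t); with n ≥ 3 neither pair of lines is {t , next t}.
  adjacent-no-swap : 0 < m → ∀ s t → Adjacent s t → ¬ Swaps t (bar s (base t)) (bar s (right (base t)))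
  adjacent-no-swap 0<m s ._ (inj₁ refl) sw with proj₁ (swaps-lines sw)
  ... | inj₁ u∈t = next≢id s (trans (sym u∈t) (cong line (bar-target s (base (next s)) refl)))
  ... | inj₂ v∈t = next≢id (next s) (trans (sym (cong line (bar-off s _ (next²≢id 0<m s) (next≢id s ∘ next-injective)))) v∈t)
  adjacent-no-swap 0<m ._ t (inj₂ refl) sw with proj₂ (swaps-lines sw)
  ... | inj₁ u∈t′ = next≢id t (trans (sym u∈t′) (cong line (bar-off (next t) (base t) (next≢id t ∘ sym) (next²≢id 0<m t ∘ sym))))
  ... | inj₂ v∈t′ = next≢id t (next-injective (trans (sym (cong line (bar-source (next t) (right (base t)) refl))) v∈t′))

  adjacent⇒≢ : ∀ {s t} → Adjacent s t → s ≢ t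
  adjacent⇒≢ {s} (inj₁ t≡s′) refl = next≢id s (sym t≡s′)
  adjacent⇒≢ {s} (inj₂ s≡t′) refl = next≢id s (sym s≡t′)

  exchange-head : ∀ s t A B → s ≢ t → Reduced (s ∷ A) → act (t ∷ B) ≗ act (s ∷ A) →
                  ∃ λ B′ → suc (length B′) ≡ length B × act (t ∷ B) ≗ act (s ∷ t ∷ B′)
  exchange-head s t A B s≢t red eq with reduced⇒crossing s A (t ∷ B) red eq
  ... | here sw = ⊥-elim (s≢t (sym (swaps-base⇒≡ sw)))
  ... | there c = delete-crossing (bar-isCoverMap t) s B c

  braid-exchange : 0 < m → ∀ s t B B′ → Adjacent s t → Reduced (t ∷ B) → act (s ∷ t ∷ B′) ≗ act (t ∷ B) →
                   ∃ λ D → suc (length D) ≡ length B′ × act (s ∷ t ∷ B′) ≗ act (t ∷ s ∷ t ∷ D)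
  braid-exchange 0<m s t B B′ adj red eq with reduced⇒crossing t B (s ∷ t ∷ B′) red eq
  ... | here sw         = ⊥-elim (adjacent⇒≢ adj (swaps-base⇒≡ sw))
  ... | there (here sw) = ⊥-elim (adjacent-no-swap 0<m s t adj sw)
  ... | there (there c) = delete-crossing (∘-isCoverMap (bar-isCoverMap t) (bar-isCoverMap s)) t B′ c

  Connected : ℕ → Set
  Connected K = ∀ A B → length A ≤ K → act A ≗ act B → Reduced A → Reduced B → Reconf A B

  connect-via-move : ∀ {K} → Connected K → ∀ {s t A B X Y} → length A ≤ K →
                     Reduced (s ∷ A) → Reduced (t ∷ B) → act (s ∷ A) ≗ act (t ∷ B) →
                     Move (s ∷ X) (t ∷ Y) → act (s ∷ X) ≗ act (t ∷ Y) → act (t ∷ Y) ≗ act (t ∷ B) →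
                     length X ≡ length Y → length Y ≡ length B → Reconf (s ∷ A) (t ∷ B)
  connect-via-move {K} ih {s} {t} {A} {B} {X} {Y} A≤K redA redB eq move eqXY eqY lenXY lenY =
    prepend s (ih A X A≤K eqAX redA′ redX) ◅◅ (move ◅ prepend t (ih Y B Y≤K eqYB redY redB′))
    where
      redA′ = reduced-tail s A redA
      redB′ = reduced-tail t B redB
      eqAX : act A ≗ act X
      eqAX = act-cancelˡ s A X (λ p → trans (eq p) (sym (trans (eqXY p) (eqY p))))
      eqYB : act Y ≗ act B
      eqYB = act-cancelˡ t Y B eqY
      lenAB : length A ≡ length B
      lenAB = ℕₚ.suc-injective (reduced-length (s ∷ A) (t ∷ B) redA redB eq)
      redX : Reduced X
      redX = reduced-resp A X redA′ (sym ∘ eqAX) (trans lenXY (trans lenY (sym lenAB)))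
      redY : Reduced Y
      redY = reduced-resp B Y redB′ eqYB lenY
      Y≤K : length Y ≤ K
      Y≤K = subst (_≤ K) (trans lenAB (sym lenY)) A≤K

  distinct-heads : ∀ {K} → Connected K → 0 < m → ∀ s t A B → s ≢ t → length A ≤ K →
                   Reduced (s ∷ A) → Reduced (t ∷ B) → act (s ∷ A) ≗ act (t ∷ B) → Reconf (s ∷ A) (t ∷ B)
  distinct-heads ih 0<m s t A B s≢t A≤K redA redB eq
    with exchange-head s t A B s≢t redA (sym ∘ eq) | adjacent-or-disjoint s t s≢t
  ... | B′ , lenB′ , eqB′ | inj₂ disj =
    connect-via-move ih A≤K redA redB eq (inj₁ (comm [] B′ s t disj))
      commuted (λ p → trans (sym (commuted p)) (sym (eqB′ p))) refl lenB′
    where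
      commuted : act (s ∷ t ∷ B′) ≗ act (t ∷ s ∷ B′)
      commuted = cong (act B′) ∘ sym ∘ bar-comm s t disj
  ... | B′ , lenB′ , eqB′ | inj₁ adj with braid-exchange 0<m s t B B′ adj redB (sym ∘ eqB′)
  ...   | D , lenD , eqD with braid-move 0<m s t D adj
  ...     | braided , move =
    connect-via-move ih A≤K redA redB eq move
      braided (λ p → trans (sym (eqD p)) (sym (eqB′ p))) refl (trans (cong suc lenD) lenB′)

  HeadsAgree : Set
  HeadsAgree = ∀ s t A B → Reduced (s ∷ A) → Reduced (t ∷ B) → act (s ∷ A) ≗ act (t ∷ B) → s ≡ t

  matsumoto : 0 < m ⊎ HeadsAgree → ∀ K → Connected K
  matsumoto _ K [] [] _ _ _ _ = ε
  matsumoto _ K [] (b ∷ B) _ eq _ redB with () ← redB [] eq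
  matsumoto _ K (a ∷ A) [] _ eq redA _ with () ← redA [] (sym ∘ eq)
  matsumoto _ zero (a ∷ A) (b ∷ B) () _ _ _
  matsumoto h (suc K) (s ∷ A) (t ∷ B) A≤K eq redA redB with s Fin.≟ t
  ... | yes refl = prepend s (matsumoto h K A B (ℕₚ.≤-pred A≤K) (act-cancelˡ s A B eq)
                                        (reduced-tail s A redA) (reduced-tail s B redB))
  ... | no s≢t with h
  ...   | inj₁ 0<m   = distinct-heads (matsumoto h K) 0<m s t A B s≢t (ℕₚ.≤-pred A≤K) redA redB eq
  ...   | inj₂ agree = ⊥-elim (s≢t (agree s t A B redA redB eq))

  -- Runs of a lottery

  applyBar-source : ∀ k (σ : State n) → applyBar k σ k ≡ σ (next k)
  applyBar-source k σ with k Fin.≟ k | k Fin.≟ next k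
  ... | yes _ | _ = refl
  ... | no k≢k | _ = ⊥-elim (k≢k refl)

  applyBar-target : ∀ k (σ : State n) → applyBar k σ (next k) ≡ σ k
  applyBar-target k σ with next k Fin.≟ k | next k Fin.≟ next k
  ... | yes k′≡k | _      = ⊥-elim (next≢id k k′≡k)
  ... | no _     | yes _  = refl
  ... | no _     | no k′≢k′ = ⊥-elim (k′≢k′ refl)

  applyBar-off : ∀ k (σ : State n) j → j ≢ k → j ≢ next k → applyBar k σ j ≡ σ j
  applyBar-off k σ j j≢k j≢k′ with j Fin.≟ k | j Fin.≟ next k
  ... | yes j≡k | _        = ⊥-elim (j≢k j≡k)
  ... | no _    | yes j≡k′ = ⊥-elim (j≢k′ j≡k′)
  ... | no _    | no _     = refl

  updDV-right : ∀ k (σ : State n) d e → e ≡ σ k → e ≢ σ (next k) → updDV k σ d e ≡ d e + 1ℤ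
  updDV-right k σ d e e≡ e≢ with e Fin.≟ σ k | e Fin.≟ σ (next k)
  ... | _     | yes e≡′ = ⊥-elim (e≢ e≡′)
  ... | yes _ | no _    = refl
  ... | no e≢′ | no _   = ⊥-elim (e≢′ e≡)

  updDV-left : ∀ k (σ : State n) d e → e ≢ σ k → e ≡ σ (next k) → updDV k σ d e ≡ d e + -1ℤ
  updDV-left k σ d e e≢ e≡ with e Fin.≟ σ k | e Fin.≟ σ (next k)
  ... | yes e≡′ | _      = ⊥-elim (e≢ e≡′)
  ... | no _    | yes _  = refl
  ... | no _    | no e≢′ = ⊥-elim (e≢′ e≡)

  updDV-stay : ∀ k (σ : State n) d e → e ≢ σ k → e ≢ σ (next k) → updDV k σ d e ≡ d e
  updDV-stay k σ d e e≢ e≢′ with e Fin.≟ σ k | e Fin.≟ σ (next k)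
  ... | yes e≡ | _      = ⊥-elim (e≢ e≡)
  ... | no _   | yes e≡ = ⊥-elim (e≢′ e≡)
  ... | no _   | no _   = refl

  -- S e is the point of the cover reached by element e, whose displacement is d e.
  record Tracks (σ : State n) (d : Fin n → ℤ) (S : Fin n → Pos) : Set where
    field
      carried   : ∀ e → σ (line (S e)) ≡ e
      located   : ∀ j → line (S (σ j)) ≡ j
      displaced : ∀ e → d e + + toℕ e ≡ toℤ (S e)

  open Tracks

  step-tracks : ∀ k σ d S → Tracks σ d S → Tracks (applyBar k σ) (updDV k σ d) (bar k ∘ S)
  step-tracks k σ d S T = record { carried = carried′ ; located = located′ ; displaced = displaced′ }
    where
      open ≡-Reasoning

      carried′ : ∀ e → applyBar k σ (line (bar k (S e))) ≡ e
      carried′ e with side k (line (S e))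
      ... | source Se∈k = begin
        applyBar k σ (line (bar k (S e))) ≡⟨ cong (applyBar k σ ∘ line) (bar-source k (S e) Se∈k) ⟩
        applyBar k σ (next (line (S e)))  ≡⟨ cong (applyBar k σ ∘ next) Se∈k ⟩
        applyBar k σ (next k)             ≡⟨ applyBar-target k σ ⟩
        σ k                               ≡⟨ cong σ Se∈k ⟨
        σ (line (S e))                    ≡⟨ carried T e ⟩
        e                                 ∎
      ... | target Se∈k′ = begin
        applyBar k σ (line (bar k (S e))) ≡⟨ cong (applyBar k σ ∘ line) (bar-target k (S e) Se∈k′) ⟩
        applyBar k σ k                    ≡⟨ applyBar-source k σ ⟩
        σ (next k)                        ≡⟨ cong σ Se∈k′ ⟨
        σ (line (S e))                    ≡⟨ carried T e ⟩
        e                                 ∎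
      ... | off Se∉k Se∉k′ = begin
        applyBar k σ (line (bar k (S e))) ≡⟨ cong (applyBar k σ ∘ line) (bar-off k (S e) Se∉k Se∉k′) ⟩
        applyBar k σ (line (S e))         ≡⟨ applyBar-off k σ _ Se∉k Se∉k′ ⟩
        σ (line (S e))                    ≡⟨ carried T e ⟩
        e                                 ∎

      located′ : ∀ j → line (bar k (S (applyBar k σ j))) ≡ j
      located′ j with side k j
      ... | source refl = begin
        line (bar k (S (applyBar k σ k))) ≡⟨ cong (line ∘ bar k ∘ S) (applyBar-source k σ) ⟩
        line (bar k (S (σ (next k))))     ≡⟨ cong line (bar-target k _ (located T (next k))) ⟩
        k                                 ∎
      ... | target refl = begin
        line (bar k (S (applyBar k σ (next k)))) ≡⟨ cong (line ∘ bar k ∘ S) (applyBar-target k σ) ⟩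
        line (bar k (S (σ k)))                   ≡⟨ cong line (bar-source k _ (located T k)) ⟩
        next (line (S (σ k)))                    ≡⟨ cong next (located T k) ⟩
        next k                                   ∎
      ... | off j≢k j≢k′ = begin
        line (bar k (S (applyBar k σ j))) ≡⟨ cong (line ∘ bar k ∘ S) (applyBar-off k σ j j≢k j≢k′) ⟩
        line (bar k (S (σ j)))            ≡⟨ cong line (bar-off k _ (j≢k ∘ trans (sym (located T j))) (j≢k′ ∘ trans (sym (located T j)))) ⟩
        line (S (σ j))                    ≡⟨ located T j ⟩
        j                                 ∎

      on-line : ∀ {e j} → e ≡ σ j → line (S e) ≡ j
      on-line refl = located T _

      displaced′ : ∀ e → updDV k σ d e + + toℕ e ≡ toℤ (bar k (S e))
      displaced′ e with side k (line (S e))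
      ... | source Se∈k = begin
        updDV k σ d e + + toℕ e ≡⟨ cong (_+ + toℕ e) (updDV-right k σ d e e≡ (λ e≡′ → next≢id k (trans (sym (on-line e≡′)) Se∈k))) ⟩
        d e + 1ℤ + + toℕ e      ≡⟨ +-swapʳ (d e) 1ℤ (+ toℕ e) ⟩
        d e + + toℕ e + 1ℤ      ≡⟨ cong (_+ 1ℤ) (displaced T e) ⟩
        toℤ (S e) + 1ℤ          ≡⟨ toℤ-bar-source k (S e) Se∈k ⟨
        toℤ (bar k (S e))       ∎
        where e≡ = trans (sym (carried T e)) (cong σ Se∈k)
      ... | target Se∈k′ = begin
        updDV k σ d e + + toℕ e ≡⟨ cong (_+ + toℕ e) (updDV-left k σ d e (λ e≡′ → next≢id k (trans (sym Se∈k′) (on-line e≡′))) e≡) ⟩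
        d e + -1ℤ + + toℕ e     ≡⟨ +-swapʳ (d e) -1ℤ (+ toℕ e) ⟩
        d e + + toℕ e + -1ℤ     ≡⟨ cong (_+ -1ℤ) (displaced T e) ⟩
        toℤ (S e) + -1ℤ         ≡⟨ toℤ-bar-target k (S e) Se∈k′ ⟨
        toℤ (bar k (S e))       ∎
        where e≡ = trans (sym (carried T e)) (cong σ Se∈k′)
      ... | off Se∉k Se∉k′ = begin
        updDV k σ d e + + toℕ e ≡⟨ cong (_+ + toℕ e) (updDV-stay k σ d e (Se∉k ∘ on-line) (Se∉k′ ∘ on-line)) ⟩
        d e + + toℕ e           ≡⟨ displaced T e ⟩
        toℤ (S e)               ≡⟨ cong toℤ (bar-off k (S e) Se∉k Se∉k′) ⟨
        toℤ (bar k (S e))       ∎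

  run-tracks : ∀ W σ d S → Tracks σ d S → Tracks (proj₁ (run σ d W)) (proj₂ (run σ d W)) (act W ∘ S)
  run-tracks []      σ d S T = T
  run-tracks (k ∷ W) σ d S T = run-tracks W (applyBar k σ) (updDV k σ d) (bar k ∘ S) (step-tracks k σ d S T)

  final-tracks : ∀ L → Tracks (final L) (DV L) (act L ∘ base)
  final-tracks L = run-tracks L initState (λ _ → 0ℤ) base (record
    { carried   = λ _ → refl
    ; located   = λ _ → refl
    ; displaced = λ e → sym (trans (cong (_+_ (+ toℕ e)) (ℤₚ.*-zeroʳ (+ n))) (ℤₚ.+-identityʳ (+ toℕ e)))
    })

  agree-on-base : ∀ {f g} → IsCoverMap f → IsCoverMap g → (∀ j → f (base j) ≡ g (base j)) → f ≗ g
  agree-on-base {f} {g} F G eq p = begin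
    f p                        ≡⟨ cong f p≡ ⟩
    f (shift w (base (line p))) ≡⟨ shift-comm F w (base (line p)) ⟩
    shift w (f (base (line p))) ≡⟨ cong (shift w) (eq (line p)) ⟩
    shift w (g (base (line p))) ≡⟨ shift-comm G w (base (line p)) ⟨
    g (shift w (base (line p))) ≡⟨ cong g p≡ ⟨
    g p                        ∎
    where
      open ≡-Reasoning
      w = proj₂ p - 0ℤ
      p≡ = same-line⇒shift p (base (line p)) refl

  DV-determines-act : ∀ L L′ → (∀ e → DV L e ≡ DV L′ e) → act L ≗ act L′
  DV-determines-act L L′ eq = agree-on-base (act-isCoverMap L) (act-isCoverMap L′) λ j → toℤ-injective (begin
    toℤ (act L (base j))  ≡⟨ displaced (final-tracks L) j ⟨
    DV L j + + toℕ j      ≡⟨ cong (_+ + toℕ j) (eq j) ⟩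
    DV L′ j + + toℕ j     ≡⟨ displaced (final-tracks L′) j ⟩
    toℤ (act L′ (base j)) ∎)
    where open ≡-Reasoning

  optimal⇒reduced : ∀ π L → IsOptimal π L → Reduced L
  optimal⇒reduced π L (lotL , optL) M eq = optL M λ j → trans (final-≡ j) (lotL j)
    where
      final-≡ : ∀ j → final M j ≡ final L j
      final-≡ j = line-injective (act-isCoverMap L) (base (final M j)) (base (final L j)) (begin
        line (act L (base (final M j))) ≡⟨ cong line (eq (base (final M j))) ⟨
        line (act M (base (final M j))) ≡⟨ located (final-tracks M) j ⟩
        j                               ≡⟨ located (final-tracks L) j ⟨
        line (act L (base (final L j))) ∎)
        where open ≡-Reasoning

  optimal-lotteries-connected : 0 < m ⊎ HeadsAgree → ∀ π x L L′ → InLopt π x L → InLopt π x L′ → Reconf L L′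
  optimal-lotteries-connected h π x L L′ (optL , dvL) (optL′ , dvL′) =
    matsumoto h (length L) L L′ ℕₚ.≤-refl (DV-determines-act L L′ (λ e → trans (dvL e) (sym (dvL′ e))))
      (optimal⇒reduced π L optL) (optimal⇒reduced π L′ optL′)

module TwoLines where
  open Cover 0

  next-of-other : ∀ (a b : Fin 2) → b ≢ a → b ≡ next a
  next-of-other Fin.zero           Fin.zero           b≢a = ⊥-elim (b≢a refl)
  next-of-other Fin.zero           (Fin.suc Fin.zero) _   = refl
  next-of-other (Fin.suc Fin.zero) Fin.zero           _   = refl
  next-of-other (Fin.suc Fin.zero) (Fin.suc Fin.zero) b≢a = ⊥-elim (b≢a refl)

  next-involutive : ∀ (a : Fin 2) → next (next a) ≡ a
  next-involutive Fin.zero           = refl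
  next-involutive (Fin.suc Fin.zero) = refl

  reduced-successor : ∀ a b W → Reduced (a ∷ b ∷ W) → b ≡ next a
  reduced-successor a b W red = next-of-other a b λ { refl → reduced-no-repeat a W red }

  reduced⇒ascending : ∀ a W → Reduced (a ∷ W) → Ascending a (a ∷ W)
  reduced⇒ascending a []      _   = step []
  reduced⇒ascending a (b ∷ W) red with reduced-successor a b W red
  ... | refl = step (reduced⇒ascending (next a) W (reduced-tail a (next a ∷ W) red))

  reduced⇒descending : ∀ a W → Reduced (a ∷ W) → Descending a (a ∷ W)
  reduced⇒descending a []      _   = step {b = next a} (next-involutive a) []
  reduced⇒descending a (b ∷ W) red with reduced-successor a b W red
  ... | refl = step (next-involutive a) (reduced⇒descending (next a) W (reduced-tail a (next a ∷ W) red))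

  -- With two lines the reduced words alternate, so a reduced word pushes the strand starting
  -- at its head bar monotonically right and the strand at the other line monotonically left.
  heads-agree : HeadsAgree
  heads-agree s t A B redA redB eq with s Fin.≟ t
  ... | yes s≡t = s≡t
  ... | no s≢t  = ⊥-elim (≺-asym (gap (length A) pushed-right) (gap (length B) (sym pushed-left)))
    where
      p = base s
      pushed-right : toℤ (act (s ∷ A) p) ≡ toℤ p + + suc (length A)
      pushed-right = toℤ-act-ascending p (reduced⇒ascending s A redA) refl
      pushed-left : toℤ (act (s ∷ A) p) + + suc (length B) ≡ toℤ p
      pushed-left = trans (cong (λ q → toℤ q + + suc (length B)) (eq p))
                      (toℤ-act-descending p (reduced⇒descending t B redB) (next-of-other t s s≢t))

empty-lottery₁ : (π : Permutation′ 1) → IsLotteryOf π []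
empty-lottery₁ π Fin.zero with π ⟨$⟩ʳ Fin.zero
... | Fin.zero = refl

corollary1 : (n : ℕ) (π : Permutation′ n) (x : Fin n → ℤ) → IsOptimalDV π x → (L L′ : Lottery n) → InLopt π x L → InLopt π x L′ → Reconf L L′
corollary1 0 _ _ _ [] [] _ _ = ε
corollary1 0 _ _ _ [] (() ∷ _) _ _
corollary1 0 _ _ _ (() ∷ _) _ _ _
corollary1 1 _ _ _ [] [] _ _ = ε
corollary1 1 π _ _ [] (_ ∷ _) _ ((_ , optimal) , _) with () ← optimal [] (empty-lottery₁ π)
corollary1 1 π _ _ (_ ∷ _) _ ((_ , optimal) , _) _ with () ← optimal [] (empty-lottery₁ π)
corollary1 2 π x _ = Cover.optimal-lotteries-connected 0 (inj₂ TwoLines.heads-agree) π x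
corollary1 (suc (suc (suc m))) π x _ = Cover.optimal-lotteries-connected (suc m) (inj₁ (ℕ.s≤s ℕ.z≤n)) π x
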